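{- Let $\mathcal H$ be a family of graphs. There exists a constant $c=c(\mathcal H)$ such that every connected $\mathcal H$-free graph $G$ has fewer than $c$ vertices of degree at least $2$ if and only if \[\mathcal H \le \{K_n,\ P_n,\ K_{1,n}^*,\ K_{2,n},\ K_2+nK_1,\ K_1+nK_2\}\] for some positive integer $n$.
   Context: All graphs are finite, simple and undirected. For graphs $H_1,H_2$, write $H_1\prec H_2$ if $H_2$ contains an induced subgraph isomorphic to $H_1$. A graph $G$ is $\mathcal H$-free if no $H\in\mathcal H$ satisfies $H\prec G$. For families $\mathcal H_1,\mathcal H_2$, write $\mathcal H_1\le\mathcal H_2$ if for every $H_2\in\mathcal H_2$ there is $H_1\in\mathcal H_1$ with $H_1\prec H_2$. $K_n$, $E_n$, $P_n$ denote the complete graph, the edgeless graph and the path on $n$ vertices; $K_{s,t}$ is the complete bipartite graph with parts of sizes $s,t$; $nG$ is the disjoint union of $n$ copies of $G$; $nK_1=E_n$. The join $G_1+G_2$ is the disjoint union of $G_1$ and $G_2$ together with all edges between $V(G_1)$ and $V(G_2)$. $K_{1,n}^*$ is the graph obtained from the star $K_{1,n}$ by attaching a new pendant vertex to each of its $n$ leaves. -}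

module Defs where

open import Data.Nat using (ℕ; zero; suc; _+_; _≤ᵇ_; _≡ᵇ_; _<_; _≤_)
open import Data.Fin using (Fin; zero; suc; toℕ; splitAt; _≟_)
open import Data.Bool using (Bool; true; false; not; _∧_; _∨_; if_then_else_; T)
open import Data.Sum using (_⊎_; inj₁; inj₂)
open import Data.Product using (Σ; ∃; ∃-syntax; _×_; _,_)
open import Data.List using (List; []; _∷_)
open import Data.List.Membership.Propositional using (_∈_)
open import Relation.Nullary using (¬_; does)
open import Relation.Binary.PropositionalEquality using (_≡_)
open import Function.Definitions using (Injective)

-- Any Boolean relation E
-- generates the simple graph whose adjacency is the symmetric,
-- irreflexive closure of E (so every graph is simple by construction,
-- and every simple graph arises this way).
record Graph : Set where
  constructor mkGraph
  field
    order : ℕ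
    E     : Fin order → Fin order → Bool
open Graph public

adj : (G : Graph) → Fin (order G) → Fin (order G) → Bool
adj G u v = not (does (u ≟ v)) ∧ (E G u v ∨ E G v u)

_≺_ : Graph → Graph → Set
H ≺ G = Σ (Fin (order H) → Fin (order G)) λ f →
          Injective _≡_ _≡_ f × (∀ u v → adj H u v ≡ adj G (f u) (f v))

Family : Set₁
Family = Graph → Set

Free : Family → Graph → Set
Free 𝓗 G = ∀ H → 𝓗 H → ¬ (H ≺ G)

_≤F_ : Family → Family → Set
𝓗₁ ≤F 𝓗₂ = ∀ H₂ → 𝓗₂ H₂ → ∃[ H₁ ] (𝓗₁ H₁ × (H₁ ≺ H₂))

listFamily : List Graph → Family
listFamily Hs G = G ∈ Hs

data Reach (G : Graph) : Fin (order G) → Fin (order G) → Set where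
  here : ∀ {u} → Reach G u u
  step : ∀ {u w v} → adj G u w ≡ true → Reach G w v → Reach G u v

Connected : Graph → Set
Connected G = ∀ u v → Reach G u v

countB : ∀ {n} → (Fin n → Bool) → ℕ
countB {zero}  f = 0
countB {suc n} f = (if f zero then 1 else 0) + countB (λ i → f (suc i))

degree : (G : Graph) → Fin (order G) → ℕ
degree G v = countB (adj G v)

numDeg≥2 : Graph → ℕ
numDeg≥2 G = countB (λ v → 2 ≤ᵇ degree G v)

disjUnion : Graph → Graph → Graph
disjUnion G H = mkGraph (order G + order H) e
  where
  e : Fin (order G + order H) → Fin (order G + order H) → Bool
  e u v with splitAt (order G) u | splitAt (order G) v
  ... | inj₁ a | inj₁ b = E G a b
  ... | inj₂ a | inj₂ b = E H a b
  ... | _      | _      = false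

join : Graph → Graph → Graph
join G H = mkGraph (order G + order H) e
  where
  e : Fin (order G + order H) → Fin (order G + order H) → Bool
  e u v with splitAt (order G) u | splitAt (order G) v
  ... | inj₁ a | inj₁ b = E G a b
  ... | inj₂ a | inj₂ b = E H a b
  ... | _      | _      = true

copies : ℕ → Graph → Graph
copies zero    G = mkGraph 0 (λ _ _ → false)
copies (suc n) G = disjUnion G (copies n G)

Kn : ℕ → Graph
Kn n = mkGraph n (λ _ _ → true)

En : ℕ → Graph
En n = mkGraph n (λ _ _ → false)

Pn : ℕ → Graph
Pn n = mkGraph n (λ u v → toℕ v ≡ᵇ suc (toℕ u))

Kst : ℕ → ℕ → Graph
Kst s t = join (En s) (En t)

-- K*_{1,n}: centre 0, leaves 1..n, pendant n+i attached to leaf i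
K1nStar : ℕ → Graph
K1nStar n = mkGraph (suc (n + n)) e
  where
  e : Fin (suc (n + n)) → Fin (suc (n + n)) → Bool
  e u v = ((toℕ u ≡ᵇ 0) ∧ (1 ≤ᵇ toℕ v) ∧ (toℕ v ≤ᵇ n))
        ∨ ((1 ≤ᵇ toℕ u) ∧ (toℕ u ≤ᵇ n) ∧ (toℕ v ≡ᵇ (toℕ u + n)))

targetFamily : ℕ → Family
targetFamily n = listFamily
  ( Kn n ∷ Pn n ∷ K1nStar n ∷ Kst 2 n
  ∷ join (Kn 2) (copies n (Kn 1)) ∷ join (Kn 1) (copies n (Kn 2)) ∷ [])

{-# OPTIONS --safe #-}

-- (⇒) For n = c + 3 each of the six target graphs is connected and has at least c vertices of
-- degree at least 2, so none of them is 𝓗-free: each contains a member of 𝓗.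
-- (⇐) Let G be connected and free of the six targets. No vertex v has many neighbours of degree at
-- least 2: by Ramsey they would contain a large independent set of vertices f i, each with a
-- neighbour w i ≠ v. A vertex other than v that sees n of the f i forms K_{2,n} or K₂ + nK₁ with v;
-- otherwise further applications of Ramsey leave an induced matching f i w i with the w i
-- independent and all adjacent or all non-adjacent to v, that is K₁ + nK₂ or K*_{1,n}. Now grow
-- balls around a vertex of degree at least 2, expanding only through vertices of degree at least 2:
-- a vertex first reached in round n would end an induced path on n + 1 vertices, so n rounds
-- exhaust G, and the degree bound limits the number of vertices of degree at least 2 they reach.
module Submission where

open import Defs
open import Axiom.DoubleNegationElimination using (em⇒dne)
open import Axiom.ExcludedMiddle using (ExcludedMiddle)
open import Data.Bool using (Bool; true; false; not; _∧_; _∨_; T)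
open import Data.Bool.Properties using (∨-comm; ∨-idem; ∨-zeroʳ; ∨-identityʳ; ∧-identityʳ; ∧-zeroʳ; ∨-conicalˡ; ∨-conicalʳ; ∧-conicalˡ; ∧-conicalʳ; not-involutive; not-¬; ¬-not)
open import Data.Empty using (⊥; ⊥-elim)
open import Data.Fin as Fin using (Fin; zero; suc; toℕ; splitAt; _≟_; _↑ˡ_; _↑ʳ_; punchIn; punchOut; inject₁; fromℕ)
open import Data.Fin.Properties as Finₚ using (any?; +↔⊎; punchInᵢ≢i; punchIn-injective; punchOut-injective; punchIn-punchOut)
open import Data.List.Relation.Unary.Any using (here; there)
open import Data.Nat as ℕ using (ℕ; zero; suc; _+_; _*_; _∸_; _≤_; _<_; z≤n; s≤s; _≤ᵇ_; _≡ᵇ_)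
open import Data.Nat.Properties as ℕₚ using (≤-refl; ≤-trans; ≤-reflexive; m≤n+m; n≤1+n; n<1+n; +-mono-≤; +-suc)
open import Data.Product using (Σ-syntax; ∃-syntax; _×_; _,_; proj₁; proj₂)
open import Data.Sum as Sum using (_⊎_; inj₁; inj₂)
open import Data.Sum.Function.Propositional using (_⊎-↔_)
open import Data.Vec.Functional using (_∷_; [])
open import Function.Bundles using (_⇔_; mk⇔; Inverse; Injection; _↔_; mk↔ₛ′)
open import Function.Construct.Composition using (_↔-∘_)
open import Function.Base using (_∘_)
open import Function.Definitions using (Injective)
open import Function.Properties.Inverse using (↔-refl; ↔⇒↣)
open import Level using (0ℓ)
open import Relation.Binary.Definitions using (tri<; tri≈; tri>)
open import Relation.Binary.PropositionalEquality using (_≡_; _≢_; refl; sym; trans; cong; cong₂; subst; subst₂)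
open import Relation.Nullary using (¬_; Dec; yes; no; does; contradiction)
open import Relation.Nullary.Decidable using (dec-true; dec-false)

adj-irrefl : ∀ G u → adj G u u ≡ false
adj-irrefl G u rewrite dec-true (u ≟ u) refl = refl

adj-sym : ∀ G u w → adj G u w ≡ adj G w u
adj-sym G u w with u ≟ w | w ≟ u
... | yes u≡w | yes _   = refl
... | yes u≡w | no w≢u  = contradiction (sym u≡w) w≢u
... | no u≢w  | yes w≡u = contradiction (sym w≡u) u≢w
... | no _    | no _    = ∨-comm (E G u w) (E G w u)

adj-≢ : ∀ G {u w} → u ≢ w → adj G u w ≡ (E G u w ∨ E G w u)
adj-≢ G {u} {w} u≢w = cong (λ b → not b ∧ (E G u w ∨ E G w u)) (dec-false (u ≟ w) u≢w)

adj⇒≢ : ∀ G {u w} → adj G u w ≡ true → u ≢ w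
adj⇒≢ G {u} uw refl with () ← trans (sym (adj-irrefl G u)) uw

≺-trans : ∀ {F G H} → F ≺ G → G ≺ H → F ≺ H
≺-trans (f , f-inj , f-adj) (g , g-inj , g-adj) =
  (λ u → g (f u)) , (λ eq → f-inj (g-inj eq)) , λ u w → trans (f-adj u w) (g-adj (f u) (f w))

≤F⇒Free : ∀ {𝓗 𝓣 : Family} {G} → 𝓗 ≤F 𝓣 → Free 𝓗 G → Free 𝓣 G
≤F⇒Free {G = G} 𝓗≤𝓣 𝓗-free T T∈𝓣 T≺G with H , H∈𝓗 , H≺T ← 𝓗≤𝓣 T T∈𝓣 =
  𝓗-free H H∈𝓗 (≺-trans {H} {T} {G} H≺T T≺G)

Reach-trans : ∀ {G u v w} → Reach G u v → Reach G v w → Reach G u w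
Reach-trans here        q = q
Reach-trans (step e p) q = step e (Reach-trans p q)

Reach-sym : ∀ {G u v} → Reach G u v → Reach G v u
Reach-sym here = here
Reach-sym {G} (step {u} {w} e p) = Reach-trans (Reach-sym p) (step (trans (adj-sym G w u) e) here)

connected-from-hub : ∀ G (z : Fin (order G)) → (∀ u → Reach G u z) → Connected G
connected-from-hub G z toHub u v = Reach-trans (toHub u) (Reach-sym (toHub v))

∨-introˡ : ∀ {a} b → a ≡ true → a ∨ b ≡ true
∨-introˡ b refl = refl

∨-introʳ : ∀ a {b} → b ≡ true → a ∨ b ≡ true
∨-introʳ a refl = ∨-zeroʳ a

not≡true⇒≡false : ∀ {x} → not x ≡ true → x ≡ false
not≡true⇒≡false {x} eq = trans (sym (not-involutive x)) (cong not eq)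

≤ᵇ-true : ∀ {a b} → a ≤ b → (a ≤ᵇ b) ≡ true
≤ᵇ-true {a} {b} = dec-true (a ℕ.≤? b)

≤ᵇ-false : ∀ {a b} → ¬ a ≤ b → (a ≤ᵇ b) ≡ false
≤ᵇ-false {a} {b} = dec-false (a ℕ.≤? b)

≤ᵇ-sound : ∀ {a b} → (a ≤ᵇ b) ≡ true → a ≤ b
≤ᵇ-sound {a} {b} eq = ℕₚ.≤ᵇ⇒≤ a b (subst T (sym eq) _)

≡ᵇ-false : ∀ {a b} → a ≢ b → (a ≡ᵇ b) ≡ false
≡ᵇ-false {a} {b} = dec-false (a ℕ.≟ b)

does-sym : ∀ {n} (i j : Fin n) → does (i ≟ j) ≡ does (j ≟ i)
does-sym i j with i ≟ j | j ≟ i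
... | yes _   | yes _   = refl
... | yes i≡j | no  j≢i = contradiction (sym i≡j) j≢i
... | no  i≢j | yes j≡i = contradiction (sym j≡i) i≢j
... | no  _   | no  _   = refl

does-injective : ∀ {k m} {s : Fin k → Fin m} → Injective _≡_ _≡_ s →
                 ∀ i j → does (s i ≟ s j) ≡ does (i ≟ j)
does-injective {s = s} s-inj i j with i ≟ j
... | yes refl = dec-true (s i ≟ s i) refl
... | no  i≢j  = dec-false (s i ≟ s j) (λ eq → i≢j (s-inj eq))

countB-mono : ∀ {n} (f g : Fin n → Bool) → (∀ i → f i ≡ true → g i ≡ true) → countB f ≤ countB g
countB-mono {zero}  f g f⇒g = z≤n
countB-mono {suc n} f g f⇒g with f zero in f0 | g zero in g0
... | true  | true  = s≤s (countB-mono _ _ (λ i → f⇒g (suc i)))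
... | true  | false with () ← trans (sym (f⇒g zero f0)) g0
... | false | true  = ≤-trans (countB-mono _ _ (λ i → f⇒g (suc i))) (n≤1+n _)
... | false | false = countB-mono _ _ (λ i → f⇒g (suc i))

countB-false : ∀ {n} → countB {n} (λ _ → false) ≡ 0
countB-false {zero}  = refl
countB-false {suc n} = countB-false {n}

countB-≟ : ∀ {n} (v : Fin n) → countB (λ u → does (u ≟ v)) ≡ 1
countB-≟ {suc n} zero    = cong suc (countB-false {n})
countB-≟ {suc n} (suc v) = countB-≟ v

countB-complement : ∀ {n} (f : Fin n → Bool) → countB f + countB (λ i → not (f i)) ≡ n
countB-complement {zero}  f = refl
countB-complement {suc n} f with f zero
... | true  = cong suc (countB-complement (λ i → f (suc i)))
... | false = trans (+-suc _ _) (cong suc (countB-complement (λ i → f (suc i))))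

countB-∨ : ∀ {n} (f g : Fin n → Bool) → countB (λ i → f i ∨ g i) ≤ countB f + countB g
countB-∨ {zero}  f g = z≤n
countB-∨ {suc n} f g with f zero | g zero | countB-∨ (λ i → f (suc i)) (λ i → g (suc i))
... | true  | true  | IH = s≤s (≤-trans IH (+-mono-≤ (≤-refl {countB (λ i → f (suc i))}) (n≤1+n _)))
... | true  | false | IH = s≤s IH
... | false | true  | IH = ≤-trans (s≤s IH) (≤-reflexive (sym (+-suc _ _)))
... | false | false | IH = IH

anyB : ∀ {n} → (Fin n → Bool) → Bool
anyB {zero}  f = false
anyB {suc n} f = f zero ∨ anyB (λ i → f (suc i))

anyB-intro : ∀ {n} (f : Fin n → Bool) i → f i ≡ true → anyB f ≡ true
anyB-intro f zero    fi = ∨-introˡ _ fi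
anyB-intro f (suc i) fi = ∨-introʳ (f zero) (anyB-intro (λ i → f (suc i)) i fi)

anyB-elim : ∀ {n} (f : Fin n → Bool) → anyB f ≡ true → Σ[ i ∈ Fin n ] (f i ≡ true)
anyB-elim {suc n} f any with f zero in f0
... | true  = zero , f0
... | false with i , fi ← anyB-elim (λ i → f (suc i)) any = suc i , fi

countB-anyB : ∀ {k n} R (X : Fin k → Bool) (N : Fin k → Fin n → Bool) →
              (∀ x → X x ≡ true → countB (N x) ≤ R) → countB (λ u → anyB (λ x → X x ∧ N x u)) ≤ R * countB X
countB-anyB {zero}  {n} R X N N≤R = ≤-reflexive (trans (countB-false {n}) (sym (ℕₚ.*-zeroʳ R)))
countB-anyB {suc k} {n} R X N N≤R with X zero in X0
... | true  = ≤-trans (countB-∨ (N zero) _) (≤-trans (+-mono-≤ (N≤R zero X0) IH) (≤-reflexive (sym (ℕₚ.*-suc R _))))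
  where IH = countB-anyB R (λ x → X (suc x)) (λ x → N (suc x)) (λ x → N≤R (suc x))
... | false = countB-anyB R (λ x → X (suc x)) (λ x → N (suc x)) (λ x → N≤R (suc x))

Increasing : ∀ {k M} → (Fin k → Fin M) → Set
Increasing g = ∀ {i j} → i Fin.< j → g i Fin.< g j

increasing⇒injective : ∀ {k M} {g : Fin k → Fin M} → Increasing g → Injective _≡_ _≡_ g
increasing⇒injective {g = g} g-inc {i} {j} gi≡gj with Finₚ.<-cmp i j
... | tri< i<j _ _ = contradiction gi≡gj (Finₚ.<⇒≢ (g-inc i<j))
... | tri≈ _ i≡j _ = i≡j
... | tri> _ _ j<i = contradiction (sym gi≡gj) (Finₚ.<⇒≢ (g-inc j<i))

increasing-∘ : ∀ {a b c} {g : Fin b → Fin c} {h : Fin a → Fin b} →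
               Increasing g → Increasing h → Increasing (λ i → g (h i))
increasing-∘ g-inc h-inc i<j = g-inc (h-inc i<j)

increasing-∷ : ∀ {k M} {x : Fin M} {g : Fin k → Fin M} →
               (∀ i → x Fin.< g i) → Increasing g → Increasing (x ∷ g)
increasing-∷ x<g g-inc {zero}  {suc j} _         = x<g j
increasing-∷ x<g g-inc {suc i} {suc j} (s≤s i<j) = g-inc i<j

increasing-suc : ∀ {k M} {g : Fin k → Fin M} → Increasing g → Increasing (λ i → suc (g i))
increasing-suc g-inc i<j = s≤s (g-inc i<j)

record Enumeration {M} (p : Fin M → Bool) (k : ℕ) : Set where
  constructor enumeration
  field
    pick       : Fin k → Fin M
    increasing : Increasing pick
    satisfies  : ∀ i → p (pick i) ≡ true

enumerate : ∀ {M} (p : Fin M → Bool) k → k ≤ countB p → Enumeration p k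
enumerate p zero _ = enumeration (λ ()) (λ {i} → ⊥-elim (Finₚ.¬Fin0 i)) (λ ())
enumerate {suc M} p (suc k) k<count with p zero in p0
... | true with enumeration g g-inc pg ← enumerate (λ i → p (suc i)) k (ℕ.s≤s⁻¹ k<count) =
  enumeration (zero ∷ λ i → suc (g i)) (increasing-∷ (λ _ → s≤s z≤n) (increasing-suc g-inc)) λ where
    zero    → p0
    (suc i) → pg i
... | false with enumeration g g-inc pg ← enumerate (λ i → p (suc i)) (suc k) k<count =
  enumeration (λ i → suc (g i)) (increasing-suc g-inc) pg

private
  punchOut-zero : ∀ {k M} (p : Fin (suc M) → Bool) (g : Fin k → Fin (suc M)) →
                  Injective _≡_ _≡_ g → (∀ i → zero ≢ g i) → (∀ i → p (g i) ≡ true) →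
                  Σ[ g′ ∈ (Fin k → Fin M) ] (Injective _≡_ _≡_ g′ × (∀ i → p (suc (g′ i)) ≡ true))
  punchOut-zero p g g-inj 0∉g pg =
    (λ i → punchOut (0∉g i)) ,
    (λ eq → g-inj (punchOut-injective (0∉g _) (0∉g _) eq)) ,
    (λ i → subst (λ x → p x ≡ true) (sym (punchIn-punchOut (0∉g i))) (pg i))

injective⇒≤countB : ∀ {k M} (p : Fin M → Bool) (g : Fin k → Fin M) →
                    Injective _≡_ _≡_ g → (∀ i → p (g i) ≡ true) → k ≤ countB p
injective⇒≤countB {zero}          p g _ _ = z≤n
injective⇒≤countB {suc k} {zero}  p g _ _ with () ← g zero
injective⇒≤countB {suc k} {suc M} p g g-inj pg with any? (λ i → zero ≟ g i)
... | no 0∉g with g′ , g′-inj , pg′ ← punchOut-zero p g g-inj (λ i 0≡gi → 0∉g (i , 0≡gi)) pg =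
  ≤-trans (injective⇒≤countB _ g′ g′-inj pg′) (m≤n+m _ _)
... | yes (i₀ , 0≡gi₀)
      with g′ , g′-inj , pg′ ← punchOut-zero p (λ j → g (punchIn i₀ j))
                                 (λ eq → punchIn-injective i₀ _ _ (g-inj eq))
                                 (λ j 0≡g → punchInᵢ≢i i₀ j (g-inj (trans (sym 0≡g) 0≡gi₀)))
                                 (λ j → pg (punchIn i₀ j))
      rewrite subst (λ x → p x ≡ true) (sym 0≡gi₀) (pg i₀) =
  s≤s (injective⇒≤countB _ g′ g′-inj pg′)

trues-or-falses : ∀ {M} (p : Fin M → Bool) a b → a + b ≤ M →
                  Enumeration p a ⊎ Enumeration (λ i → not (p i)) b
trues-or-falses p a b a+b≤M with a ℕ.≤? countB p
... | yes a≤#p = inj₁ (enumerate p a a≤#p)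
... | no  a≰#p = inj₂ (enumerate _ b (ℕₚ.+-cancelˡ-≤ a b _ a+b≤a+#¬p))
  where
  a+b≤a+#¬p : a + b ≤ a + countB (λ i → not (p i))
  a+b≤a+#¬p = ≤-trans a+b≤M (≤-trans (≤-reflexive (sym (countB-complement p)))
                                      (ℕₚ.+-monoˡ-≤ _ (ℕₚ.<⇒≤ (ℕₚ.≰⇒> a≰#p))))

constant-subsequence : ∀ n (p : Fin (n + n) → Bool) →
                       Σ[ b ∈ Bool ] Σ[ g ∈ (Fin n → Fin (n + n)) ] (Increasing g × (∀ i → p (g i) ≡ b))
constant-subsequence n p with trues-or-falses p n n ≤-refl
... | inj₁ (enumeration g g-inc pg)  = true  , g , g-inc , pg
... | inj₂ (enumeration g g-inc ¬pg) = false , g , g-inc , λ i → not≡true⇒≡false (¬pg i)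

deg≥2 : (G : Graph) → Fin (order G) → Bool
deg≥2 G u = 2 ≤ᵇ degree G u

two-neighbours⇒deg≥2 : ∀ G {u w₁ w₂} → w₁ ≢ w₂ → adj G u w₁ ≡ true → adj G u w₂ ≡ true →
                       deg≥2 G u ≡ true
two-neighbours⇒deg≥2 G {u} {w₁} {w₂} w₁≢w₂ uw₁ uw₂ =
  ≤ᵇ-true (injective⇒≤countB (adj G u) (w₁ ∷ w₂ ∷ []) inj adjacent)
  where
  inj : Injective _≡_ _≡_ (w₁ ∷ w₂ ∷ [])
  inj {zero}     {zero}     _  = refl
  inj {zero}     {suc zero} eq = contradiction eq w₁≢w₂
  inj {suc zero} {zero}     eq = contradiction (sym eq) w₁≢w₂
  inj {suc zero} {suc zero} _  = refl
  adjacent : ∀ i → adj G u ((w₁ ∷ w₂ ∷ []) i) ≡ true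
  adjacent zero       = uw₁
  adjacent (suc zero) = uw₂

deg≥2⇒another-neighbour : ∀ G {u} → deg≥2 G u ≡ true →
                          ∀ v → Σ[ w ∈ Fin (order G) ] (w ≢ v × adj G u w ≡ true)
deg≥2⇒another-neighbour G {u} u≥2 v with enumerate (adj G u) 2 (≤ᵇ-sound u≥2)
... | enumeration w w-inc uw with w zero ≟ v
...   | no  w₀≢v = w zero , w₀≢v , uw zero
...   | yes w₀≡v =
  w (suc zero) , (λ w₁≡v → contradiction (trans w₀≡v (sym w₁≡v)) (Finₚ.<⇒≢ (w-inc (s≤s z≤n)))) , uw (suc zero)

-- Ramsey's theorem
ramseyBound : ℕ → ℕ → ℕ
ramseyBound zero    b       = 0
ramseyBound (suc a) zero    = 0
ramseyBound (suc a) (suc b) = suc (ramseyBound a (suc b) + ramseyBound (suc a) b)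

record Monochromatic {M} (r : Fin M → Fin M → Bool) (c : Bool) (a : ℕ) : Set where
  constructor monochromatic
  field
    pick       : Fin a → Fin M
    increasing : Increasing pick
    coloured   : ∀ {i j} → i Fin.< j → r (pick i) (pick j) ≡ c

private
  monochromatic-empty : ∀ {M} {r : Fin M → Fin M → Bool} {c} → Monochromatic r c 0
  monochromatic-empty = monochromatic (λ ()) (λ {i} → ⊥-elim (Finₚ.¬Fin0 i)) λ {i} → ⊥-elim (Finₚ.¬Fin0 i)

  module _ {M : ℕ} (r : Fin (suc M) → Fin (suc M) → Bool) {m : ℕ} {h : Fin m → Fin M} (h-inc : Increasing h)
           {c : Bool} {a : ℕ} where

    monochromatic-lift : Monochromatic (λ i j → r (suc (h i)) (suc (h j))) c a → Monochromatic r c a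
    monochromatic-lift (monochromatic g g-inc rg) =
      monochromatic (λ i → suc (h (g i))) (increasing-suc (increasing-∘ h-inc g-inc)) rg

    monochromatic-cons : (∀ j → r zero (suc (h j)) ≡ c) →
                         Monochromatic (λ i j → r (suc (h i)) (suc (h j))) c a → Monochromatic r c (suc a)
    monochromatic-cons r0h (monochromatic g g-inc rg) =
      monochromatic (zero ∷ λ i → suc (h (g i)))
                    (increasing-∷ (λ _ → s≤s z≤n) (increasing-suc (increasing-∘ h-inc g-inc)))
                    coloured
      where
      coloured : ∀ {i j} → i Fin.< j → r ((zero ∷ λ i → suc (h (g i))) i) ((zero ∷ λ i → suc (h (g i))) j) ≡ c
      coloured {zero}  {suc j} _         = r0h (g j)
      coloured {suc i} {suc j} (s≤s i<j) = rg i<j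

ramsey : ∀ a b {M} (r : Fin M → Fin M → Bool) → ramseyBound a b ≤ M →
         Monochromatic r true a ⊎ Monochromatic r false b
ramsey zero    b       r _ = inj₁ monochromatic-empty
ramsey (suc a) zero    r _ = inj₂ monochromatic-empty
ramsey (suc a) (suc b) {suc M} r (s≤s bound)
  with trues-or-falses (λ j → r zero (suc j)) (ramseyBound a (suc b)) (ramseyBound (suc a) b) bound
... | inj₁ (enumeration h h-inc r0h) =
  Sum.map (monochromatic-cons r h-inc r0h) (monochromatic-lift r h-inc) (ramsey a (suc b) _ ≤-refl)
... | inj₂ (enumeration h h-inc ¬r0h) =
  Sum.map (monochromatic-lift r h-inc) (monochromatic-cons r h-inc (λ j → not≡true⇒≡false (¬r0h j)))
          (ramsey (suc a) b _ ≤-refl)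

inject₁-increasing : ∀ {n} → Increasing (inject₁ {n})
inject₁-increasing {i = i} {j} i<j =
  subst₂ ℕ._<_ (sym (Finₚ.toℕ-inject₁ i)) (sym (Finₚ.toℕ-inject₁ j)) i<j

inject₁<fromℕ : ∀ {n} (i : Fin n) → inject₁ i Fin.< fromℕ n
inject₁<fromℕ {n} i = subst₂ ℕ._<_ (sym (Finₚ.toℕ-inject₁ i)) (sym (Finₚ.toℕ-fromℕ n)) (Finₚ.toℕ<n i)

antichain-≢ : ∀ {K M} {r : Fin M → Fin M → Bool} (mono : Monochromatic (λ i j → r i j ∨ r j i) false K) →
              let open Monochromatic mono in ∀ {p q} → p ≢ q → r (pick p) (pick q) ≡ false
antichain-≢ (monochromatic c _ coloured) {p} {q} p≢q with Finₚ.<-cmp p q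
... | tri< p<q _ _ = ∨-conicalˡ _ _ (coloured p<q)
... | tri≈ _ p≡q _ = contradiction p≡q p≢q
... | tri> _ _ q<p = ∨-conicalʳ _ _ (coloured q<p)

rich-row-or-antichain : ∀ n K {M} (r : Fin M → Fin M → Bool) →
                        ramseyBound (suc n) (ramseyBound (suc n) K) ≤ M →
                        (Σ[ i ∈ Fin M ] Enumeration (r i) n) ⊎ Monochromatic (λ i j → r i j ∨ r j i) false K
rich-row-or-antichain n K r bound with ramsey (suc n) (ramseyBound (suc n) K) r bound
... | inj₁ (monochromatic g g-inc rg) =
  inj₁ (g zero , enumeration (λ j → g (suc j)) (λ i<j → g-inc (s≤s i<j)) (λ j → rg (s≤s z≤n)))
... | inj₂ (monochromatic g₁ g₁-inc rg₁) with ramsey (suc n) K (λ i j → r (g₁ j) (g₁ i)) ≤-refl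
...   | inj₁ (monochromatic g g-inc rg) =
  inj₁ (g₁ (g (fromℕ n)) ,
        enumeration (λ j → g₁ (g (inject₁ j))) (increasing-∘ g₁-inc (increasing-∘ g-inc inject₁-increasing))
                    (λ j → rg (inject₁<fromℕ j)))
...   | inj₂ (monochromatic g₂ g₂-inc rg₂) =
  inj₂ (monochromatic (λ i → g₁ (g₂ i)) (increasing-∘ g₁-inc g₂-inc)
                      (λ i<j → cong₂ _∨_ (rg₁ (g₂-inc i<j)) (rg₂ i<j)))

-- Lets the target graphs be handled on readable vertex types instead of Fin (order T).
record Presentation (T : Graph) {V : Set} (edge : V → V → Bool) : Set where
  field
    naming : Fin (order T) ↔ V

  open Inverse naming public using (to; from; strictlyInverseˡ; strictlyInverseʳ)

  field
    adj≡edge : ∀ u w → u ≢ w → adj T u w ≡ edge (to u) (to w)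

  to-injective : Injective _≡_ _≡_ to
  to-injective = Injection.injective (↔⇒↣ naming)

  embed : ∀ {G} (φ : V → Fin (order G)) → Injective _≡_ _≡_ φ →
          (∀ a b → a ≢ b → adj G (φ a) (φ b) ≡ edge a b) → T ≺ G
  embed {G} φ φ-inj φ-adj = (λ u → φ (to u)) , (λ eq → to-injective (φ-inj eq)) , preserves
    where
    preserves : ∀ u w → adj T u w ≡ adj G (φ (to u)) (φ (to w))
    preserves u w = by-cases (u ≟ w)
      where
      by-cases : Dec (u ≡ w) → adj T u w ≡ adj G (φ (to u)) (φ (to w))
      by-cases (yes refl) = trans (adj-irrefl T u) (sym (adj-irrefl G _))
      by-cases (no u≢w)   = trans (adj≡edge u w u≢w) (sym (φ-adj _ _ (λ eq → u≢w (to-injective eq))))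

  from-injective : Injective _≡_ _≡_ from
  from-injective {a} {b} eq = trans (sym (strictlyInverseˡ a)) (trans (cong to eq) (strictlyInverseˡ b))

  adj-from : ∀ {a b} → a ≢ b → adj T (from a) (from b) ≡ edge a b
  adj-from {a} {b} a≢b =
    trans (adj≡edge _ _ (λ eq → a≢b (from-injective eq))) (cong₂ edge (strictlyInverseˡ a) (strictlyInverseˡ b))

  reach-step : ∀ a b {w} → edge a b ≡ true → Reach T (from b) w → Reach T (from a) w
  reach-step a b ab b⇝w with from a ≟ from b
  ... | yes eq  = subst (λ x → Reach T x _) (sym eq) b⇝w
  ... | no  neq = step (trans (adj-from (λ eq → neq (cong from eq))) ab) b⇝w

  connected-via : (a₀ : V) → (∀ a → Reach T (from a) (from a₀)) → Connected T
  connected-via a₀ toHub = connected-from-hub T (from a₀) λ u →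
    subst (λ x → Reach T x (from a₀)) (strictlyInverseʳ u) (toHub (to u))

  deg≥2-via : ∀ a b₁ b₂ → b₁ ≢ b₂ → a ≢ b₁ → a ≢ b₂ → edge a b₁ ≡ true → edge a b₂ ≡ true →
              deg≥2 T (from a) ≡ true
  deg≥2-via a b₁ b₂ b₁≢b₂ a≢b₁ a≢b₂ ab₁ ab₂ =
    two-neighbours⇒deg≥2 T (λ eq → b₁≢b₂ (from-injective eq)) (trans (adj-from a≢b₁) ab₁) (trans (adj-from a≢b₂) ab₂)

  ≤numDeg≥2 : ∀ {k} (h : Fin k → V) → Injective _≡_ _≡_ h → (∀ i → deg≥2 T (from (h i)) ≡ true) →
              k ≤ numDeg≥2 T
  ≤numDeg≥2 h h-inj = injective⇒≤countB (deg≥2 T) (λ i → from (h i)) (λ eq → h-inj (from-injective eq))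

present-self : ∀ G → Presentation G (λ u w → E G u w ∨ E G w u)
present-self G = record { naming = ↔-refl ; adj≡edge = λ u w → adj-≢ G }

⊎-edge : ∀ {A B : Set} → Bool → (A → A → Bool) → (B → B → Bool) → A ⊎ B → A ⊎ B → Bool
⊎-edge b r s (inj₁ x) (inj₁ y) = r x y
⊎-edge b r s (inj₂ x) (inj₂ y) = s x y
⊎-edge b r s _        _        = b

E-join : ∀ G H u w → E (join G H) u w ≡ ⊎-edge true (E G) (E H) (splitAt (order G) u) (splitAt (order G) w)
E-join G H u w with splitAt (order G) u | splitAt (order G) w
... | inj₁ _ | inj₁ _ = refl
... | inj₁ _ | inj₂ _ = refl
... | inj₂ _ | inj₁ _ = refl
... | inj₂ _ | inj₂ _ = refl

E-disjUnion : ∀ G H u w → E (disjUnion G H) u w ≡ ⊎-edge false (E G) (E H) (splitAt (order G) u) (splitAt (order G) w)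
E-disjUnion G H u w with splitAt (order G) u | splitAt (order G) w
... | inj₁ _ | inj₁ _ = refl
... | inj₁ _ | inj₂ _ = refl
... | inj₂ _ | inj₁ _ = refl
... | inj₂ _ | inj₂ _ = refl

-- join and disjUnion compute their edges by with-abstraction, so their edge relation e is only
-- propositionally of the ⊎-edge form.
module _ {G H : Graph} {A B : Set} {r : A → A → Bool} {s : B → B → Bool}
         (PG : Presentation G r) (PH : Presentation H s) (b : Bool)
         (e : Fin (order G + order H) → Fin (order G + order H) → Bool)
         (e≡⊎-edge : ∀ u w → e u w ≡ ⊎-edge b (E G) (E H) (splitAt (order G) u) (splitAt (order G) w)) where
  private
    module PG = Presentation PG
    module PH = Presentation PH
    X = mkGraph (order G + order H) e

    adj-⊎ : ∀ x y → x ≢ y → ⊎-edge b (E G) (E H) x y ∨ ⊎-edge b (E G) (E H) y x ≡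
                              ⊎-edge b r s (Sum.map PG.to PH.to x) (Sum.map PG.to PH.to y)
    adj-⊎ (inj₁ a) (inj₁ a′) x≢y = trans (sym (adj-≢ G a≢a′)) (PG.adj≡edge a a′ a≢a′)
      where a≢a′ = λ eq → x≢y (cong inj₁ eq)
    adj-⊎ (inj₁ a) (inj₂ c) _ = ∨-idem b
    adj-⊎ (inj₂ c) (inj₁ a) _ = ∨-idem b
    adj-⊎ (inj₂ c) (inj₂ c′) x≢y = trans (sym (adj-≢ H c≢c′)) (PH.adj≡edge c c′ c≢c′)
      where c≢c′ = λ eq → x≢y (cong inj₂ eq)

  present-⊎ : Presentation X (⊎-edge b r s)
  present-⊎ = record
    { naming   = (PG.naming ⊎-↔ PH.naming) ↔-∘ +↔⊎
    ; adj≡edge = λ u w u≢w →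
        trans (adj-≢ X u≢w)
       (trans (cong₂ _∨_ (e≡⊎-edge u w) (e≡⊎-edge w u))
              (adj-⊎ _ _ λ eq → u≢w (Injection.injective (↔⇒↣ (+↔⊎ {order G} {order H})) eq)))
    }

present-join : ∀ {G H A B r s} → Presentation G {A} r → Presentation H {B} s →
               Presentation (join G H) (⊎-edge true r s)
present-join {G} {H} PG PH = present-⊎ PG PH true (E (join G H)) (E-join G H)

present-disjUnion : ∀ {G H A B r s} → Presentation G {A} r → Presentation H {B} s →
                    Presentation (disjUnion G H) (⊎-edge false r s)
present-disjUnion {G} {H} PG PH = present-⊎ PG PH false (E (disjUnion G H)) (E-disjUnion G H)

present-via : ∀ {T A B} {r : A → A → Bool} {s : B → B → Bool} → Presentation T r → (e : A ↔ B) →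
              (∀ x y → x ≢ y → s (Inverse.to e x) (Inverse.to e y) ≡ r x y) → Presentation T s
present-via P e s∘to≡r = record
  { naming   = e ↔-∘ P.naming
  ; adj≡edge = λ u w u≢w → trans (P.adj≡edge u w u≢w) (sym (s∘to≡r _ _ λ eq → u≢w (P.to-injective eq)))
  }
  where module P = Presentation P

copy-edge : ∀ {n} {A : Set} → (A → A → Bool) → Fin n × A → Fin n × A → Bool
copy-edge r (i , a) (j , b) = does (i ≟ j) ∧ r a b

⊎↔suc× : ∀ {n} {A : Set} → (A ⊎ (Fin n × A)) ↔ (Fin (suc n) × A)
⊎↔suc× = mk↔ₛ′ to from to∘from from∘to
  where
  to : _ ⊎ (Fin _ × _) → Fin (suc _) × _
  to (inj₁ a)       = zero , a
  to (inj₂ (i , a)) = suc i , a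
  from : Fin (suc _) × _ → _ ⊎ (Fin _ × _)
  from (zero  , a) = inj₁ a
  from (suc i , a) = inj₂ (i , a)
  to∘from : ∀ x → to (from x) ≡ x
  to∘from (zero  , a) = refl
  to∘from (suc i , a) = refl
  from∘to : ∀ x → from (to x) ≡ x
  from∘to (inj₁ a)       = refl
  from∘to (inj₂ (i , a)) = refl

present-copies : ∀ n {H A} {r : A → A → Bool} → Presentation H r → Presentation (copies n H) (copy-edge {n} r)
present-copies zero    PH = record { naming = mk↔ₛ′ (λ ()) (λ ()) (λ ()) (λ ()) ; adj≡edge = λ () }
present-copies (suc n) PH = present-via (present-disjUnion PH (present-copies n PH)) ⊎↔suc× edge-to
  where
  edge-to : ∀ x y → x ≢ y → _ ≡ _
  edge-to (inj₁ a)       (inj₁ b)       _ = refl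
  edge-to (inj₁ a)       (inj₂ (j , b)) _ = refl
  edge-to (inj₂ (i , a)) (inj₁ b)       _ = refl
  edge-to (inj₂ (i , a)) (inj₂ (j , b)) _ = refl

present-nK1 : ∀ n → Presentation (copies n (Kn 1)) {Fin n} (λ _ _ → false)
present-nK1 n = present-via (present-copies n (present-self (Kn 1))) ×1↔ edge-to
  where
  ×1↔ : (Fin n × Fin 1) ↔ Fin n
  ×1↔ = mk↔ₛ′ proj₁ (_, zero) (λ _ → refl) λ where (i , zero) → refl
  edge-to : ∀ x y → x ≢ y → false ≡ copy-edge (λ _ _ → true) x y
  edge-to (i , zero) (j , zero) x≢y = sym (cong (_∧ true) (dec-false (i ≟ j) λ where refl → x≢y refl))

present-Kn : ∀ n → Presentation (Kn n) (λ _ _ → true)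
present-Kn n = present-self (Kn n)

present-Pn : ∀ n → Presentation (Pn n) (λ u w → E (Pn n) u w ∨ E (Pn n) w u)
present-Pn n = present-self (Pn n)

-- The common vertex set of K*_{1,n} and K₁ + nK₂: a centre, leaves (i , 0) and pendants (i , 1);
-- the copies of K₂ in K₁ + nK₂ are the leaf–pendant pairs.
Star : ℕ → Set
Star n = Fin 1 ⊎ (Fin n × Fin 2)

pattern centre    = inj₁ zero
pattern leaf i    = inj₂ (i , zero)
pattern pendant i = inj₂ (i , suc zero)

star-arc : ∀ {n} → Star n → Star n → Bool
star-arc centre   (leaf _)    = true
star-arc (leaf i) (pendant j) = does (i ≟ j)
star-arc _        _           = false

oneHub-edge : ∀ {n} → Bool → Star n → Star n → Bool
oneHub-edge b centre      (leaf _)    = true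
oneHub-edge b centre      (pendant _) = b
oneHub-edge b (leaf _)    centre      = true
oneHub-edge b (pendant _) centre      = b
oneHub-edge b (leaf i)    (pendant j) = does (i ≟ j)
oneHub-edge b (pendant i) (leaf j)    = does (i ≟ j)
oneHub-edge b _           _           = false

star-arc-sym : ∀ {n} (a b : Star n) → star-arc a b ∨ star-arc b a ≡ oneHub-edge false a b
star-arc-sym centre      centre      = refl
star-arc-sym centre      (leaf j)    = refl
star-arc-sym centre      (pendant j) = refl
star-arc-sym (leaf i)    centre      = refl
star-arc-sym (leaf i)    (leaf j)    = refl
star-arc-sym (leaf i)    (pendant j) = ∨-identityʳ _
star-arc-sym (pendant i) centre      = refl
star-arc-sym (pendant i) (leaf j)    = does-sym j i
star-arc-sym (pendant i) (pendant j) = refl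

module _ (n : ℕ) where
  private
    to : Fin (suc (n + n)) → Star n
    to zero    = centre
    to (suc k) = Sum.[ leaf , pendant ]′ (splitAt n k)

    from : Star n → Fin (suc (n + n))
    from centre      = zero
    from (leaf i)    = suc (i ↑ˡ n)
    from (pendant i) = suc (n ↑ʳ i)

    to∘from : ∀ a → to (from a) ≡ a
    to∘from centre      = refl
    to∘from (leaf i)    rewrite Finₚ.splitAt-↑ˡ n i n = refl
    to∘from (pendant i) rewrite Finₚ.splitAt-↑ʳ n n i = refl

    from∘to : ∀ u → from (to u) ≡ u
    from∘to zero = refl
    from∘to (suc k) with splitAt n k in eq
    ... | inj₁ i = cong suc (Finₚ.splitAt⁻¹-↑ˡ eq)
    ... | inj₂ i = cong suc (Finₚ.splitAt⁻¹-↑ʳ eq)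

    leaf<n : ∀ (i : Fin n) → (suc (toℕ i) ≤ᵇ n) ≡ true
    leaf<n i = ≤ᵇ-true (Finₚ.toℕ<n i)

    pendant≮n : ∀ (i : Fin n) → (suc (n + toℕ i) ≤ᵇ n) ≡ false
    pendant≮n i = ≤ᵇ-false (ℕₚ.m+n≮m n (toℕ i))

    leaf≢leaf+n : ∀ (i j : Fin n) → (toℕ j ≡ᵇ toℕ i + n) ≡ false
    leaf≢leaf+n i j = ≡ᵇ-false λ eq → ℕₚ.<⇒≱ (Finₚ.toℕ<n j) (subst (n ≤_) (sym eq) (ℕₚ.m≤n+m n (toℕ i)))

    pendant≡leaf+n : ∀ (i j : Fin n) → (n + toℕ j ≡ᵇ toℕ i + n) ≡ does (i ≟ j)
    pendant≡leaf+n i j with i ≟ j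
    ... | yes refl = dec-true (n + toℕ i ℕ.≟ toℕ i + n) (ℕₚ.+-comm n (toℕ i))
    ... | no  i≢j  =
      ≡ᵇ-false λ eq → i≢j (Finₚ.toℕ-injective (sym (ℕₚ.+-cancelˡ-≡ n _ _ (trans eq (ℕₚ.+-comm (toℕ i) n)))))

    E-from : ∀ a b → E (K1nStar n) (from a) (from b) ≡ star-arc a b
    E-from centre      centre      = refl
    E-from centre      (leaf j)    rewrite Finₚ.toℕ-↑ˡ j n | leaf<n j = refl
    E-from centre      (pendant j) rewrite Finₚ.toℕ-↑ʳ n j | pendant≮n j = refl
    E-from (leaf i)    centre      rewrite Finₚ.toℕ-↑ˡ i n | leaf<n i = refl
    E-from (leaf i)    (leaf j)    rewrite Finₚ.toℕ-↑ˡ i n | Finₚ.toℕ-↑ˡ j n | leaf<n i | leaf≢leaf+n i j = refl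
    E-from (leaf i)    (pendant j) rewrite Finₚ.toℕ-↑ˡ i n | Finₚ.toℕ-↑ʳ n j | leaf<n i = pendant≡leaf+n i j
    E-from (pendant i) b           rewrite Finₚ.toℕ-↑ʳ n i | pendant≮n i = refl

  present-star : Presentation (K1nStar n) (oneHub-edge {n} false)
  present-star = record
    { naming   = mk↔ₛ′ to from to∘from from∘to
    ; adj≡edge = λ u w u≢w → trans (adj-≢ (K1nStar n) u≢w)
        (subst₂ (λ x y → E (K1nStar n) x y ∨ E (K1nStar n) y x ≡ oneHub-edge false (to u) (to w))
                (from∘to u) (from∘to w)
                (trans (cong₂ _∨_ (E-from (to u) (to w)) (E-from (to w) (to u))) (star-arc-sym (to u) (to w))))
    }

present-friendship : ∀ n → Presentation (join (Kn 1) (copies n (Kn 2))) (oneHub-edge {n} true)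
present-friendship n =
  present-via (present-join (present-self (Kn 1)) (present-copies n (present-self (Kn 2)))) ↔-refl edge-to
  where
  same-copy : ∀ {i j : Fin n} {a} → _≢_ {A = Star n} (inj₂ (i , a)) (inj₂ (j , a)) → does (i ≟ j) ≡ false
  same-copy {i} {j} x≢y = dec-false (i ≟ j) λ where refl → x≢y refl
  edge-to : ∀ x y → x ≢ y → oneHub-edge true x y ≡ ⊎-edge true (λ _ _ → true) (copy-edge (λ _ _ → true)) x y
  edge-to centre      centre      x≢y = contradiction refl x≢y
  edge-to centre      (leaf j)    _   = refl
  edge-to centre      (pendant j) _   = refl
  edge-to (leaf i)    centre      _   = refl
  edge-to (leaf i)    (leaf j)    x≢y = sym (cong (_∧ true) (same-copy x≢y))
  edge-to (leaf i)    (pendant j) _   = sym (∧-identityʳ _)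
  edge-to (pendant i) centre      _   = refl
  edge-to (pendant i) (leaf j)    _   = sym (∧-identityʳ _)
  edge-to (pendant i) (pendant j) x≢y = sym (cong (_∧ true) (same-copy x≢y))

oneHub : Bool → ℕ → Graph
oneHub false n = K1nStar n
oneHub true  n = join (Kn 1) (copies n (Kn 2))

present-oneHub : ∀ b n → Presentation (oneHub b n) (oneHub-edge {n} b)
present-oneHub false n = present-star n
present-oneHub true  n = present-friendship n

twoHubs : Bool → ℕ → Graph
twoHubs false n = Kst 2 n
twoHubs true  n = join (Kn 2) (copies n (Kn 1))

twoHubs-edge : ∀ {n} → Bool → Fin 2 ⊎ Fin n → Fin 2 ⊎ Fin n → Bool
twoHubs-edge b = ⊎-edge true (λ _ _ → b) (λ _ _ → false)

present-twoHubs : ∀ b n → Presentation (twoHubs b n) (twoHubs-edge {n} b)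
present-twoHubs false n = present-join (present-self (En 2)) (present-self (En n))
present-twoHubs true  n = present-join (present-self (Kn 2)) (present-nK1 n)

-- The targets are connected and have many vertices of degree at least two
Counterexample : ℕ → Graph → Set
Counterexample c T = Connected T × c ≤ numDeg≥2 T

module _ (c : ℕ) where
  private
    N : ℕ
    N = 3 + c

    c≤N : c ≤ N
    c≤N = m≤n+m c 3

  Kn-counterexample : Counterexample c (Kn N)
  Kn-counterexample =
    connected-via zero (λ a → reach-step a zero refl here) ,
    ≤-trans c≤N (≤numDeg≥2 (λ a → a) (λ eq → eq) λ a →
      deg≥2-via a (punchIn a zero) (punchIn a (suc zero)) (λ eq → 0≢1 (punchIn-injective a _ _ eq))
                (λ eq → punchInᵢ≢i a zero (sym eq)) (λ eq → punchInᵢ≢i a (suc zero) (sym eq)) refl refl)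
    where
    open Presentation (present-Kn N)
    0≢1 : zero ≢ suc zero
    0≢1 ()

  Pn-counterexample : Counterexample c (Pn N)
  Pn-counterexample = connected-via zero (λ a → to-start a refl) , ≤-trans (n≤1+n c) (≤numDeg≥2 h h-inj h≥2)
    where
    open Presentation (present-Pn N)

    consecutive : ∀ {u w : Fin N} → toℕ w ≡ suc (toℕ u) → E (Pn N) u w ∨ E (Pn N) w u ≡ true
    consecutive {u} {w} eq rewrite dec-true (toℕ w ℕ.≟ suc (toℕ u)) eq = refl

    consecutive′ : ∀ {u w : Fin N} → toℕ u ≡ suc (toℕ w) → E (Pn N) u w ∨ E (Pn N) w u ≡ true
    consecutive′ {u} {w} eq = trans (∨-comm (E (Pn N) u w) _) (consecutive eq)

    to-start : ∀ (a : Fin N) {k} → toℕ a ≡ k → Reach (Pn N) a zero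
    to-start zero    {zero}  _  = here
    to-start (suc a) {suc k} eq =
      reach-step (suc a) (inject₁ a) (consecutive′ (cong suc (sym (Finₚ.toℕ-inject₁ a))))
                 (to-start (inject₁ a) (trans (Finₚ.toℕ-inject₁ a) (ℕₚ.suc-injective eq)))

    h : Fin (suc c) → Fin N
    h i = suc (inject₁ i)

    h-inj : Injective _≡_ _≡_ h
    h-inj eq = Finₚ.inject₁-injective (Finₚ.suc-injective eq)

    h≥2 : ∀ i → deg≥2 (Pn N) (h i) ≡ true
    h≥2 i = deg≥2-via (h i) (inject₁ (inject₁ i)) (suc (suc i))
                      (Finₚ.<⇒≢ (Finₚ.<-trans before<h h<after)) (Finₚ.<⇒≢ before<h ∘ sym) (Finₚ.<⇒≢ h<after)
                      (consecutive′ (cong suc (sym (Finₚ.toℕ-inject₁ (inject₁ i)))))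
                      (consecutive (cong (λ t → suc (suc t)) (sym (Finₚ.toℕ-inject₁ i))))
      where
      before<h : inject₁ (inject₁ i) Fin.< h i
      before<h = s≤s (≤-reflexive (Finₚ.toℕ-inject₁ (inject₁ i)))
      h<after : h i Fin.< suc (suc i)
      h<after = s≤s (s≤s (≤-reflexive (Finₚ.toℕ-inject₁ i)))

  oneHub-counterexample : ∀ b → Counterexample c (oneHub b N)
  oneHub-counterexample b =
    connected-via centre to-centre , ≤-trans c≤N (≤numDeg≥2 leaf leaf-injective leaf≥2)
    where
    open Presentation (present-oneHub b N)
    leaf-pendant : ∀ i → oneHub-edge b (leaf i) (pendant i) ≡ true
    leaf-pendant i = dec-true (i ≟ i) refl
    to-centre : ∀ a → Reach (oneHub b N) (from a) (from centre)
    to-centre centre      = here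
    to-centre (leaf i)    = reach-step (leaf i) centre refl here
    to-centre (pendant i) = reach-step (pendant i) (leaf i) (leaf-pendant i) (to-centre (leaf i))
    leaf-injective : ∀ {i j : Fin N} → _≡_ {A = Star N} (leaf i) (leaf j) → i ≡ j
    leaf-injective refl = refl
    leaf≥2 : ∀ i → deg≥2 (oneHub b N) (from (leaf i)) ≡ true
    leaf≥2 i = deg≥2-via (leaf i) centre (pendant i) (λ ()) (λ ()) (λ ()) refl (leaf-pendant i)

  twoHubs-counterexample : ∀ b → Counterexample c (twoHubs b N)
  twoHubs-counterexample b =
    connected-via (inj₁ zero) to-hub , ≤-trans c≤N (≤numDeg≥2 inj₂ inj₂-injective inj₂≥2)
    where
    open Presentation (present-twoHubs b N)
    to-hub : ∀ a → Reach (twoHubs b N) (from a) (from (inj₁ zero))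
    to-hub (inj₁ zero)       = here
    to-hub (inj₁ (suc zero)) = reach-step (inj₁ (suc zero)) (inj₂ zero) refl (to-hub (inj₂ zero))
    to-hub (inj₂ i)          = reach-step (inj₂ i) (inj₁ zero) refl here
    inj₂-injective : Injective _≡_ _≡_ (inj₂ {B = Fin N})
    inj₂-injective refl = refl
    inj₂≥2 : ∀ i → deg≥2 (twoHubs b N) (from (inj₂ i)) ≡ true
    inj₂≥2 i = deg≥2-via (inj₂ i) (inj₁ zero) (inj₁ (suc zero)) (λ ()) (λ ()) (λ ()) refl refl

  targets-are-counterexamples : ∀ T → targetFamily N T → Counterexample c T
  targets-are-counterexamples T (here refl)                                 = Kn-counterexample
  targets-are-counterexamples T (there (here refl))                         = Pn-counterexample
  targets-are-counterexamples T (there (there (here refl)))                 = oneHub-counterexample false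
  targets-are-counterexamples T (there (there (there (here refl))))         = twoHubs-counterexample false
  targets-are-counterexamples T (there (there (there (there (here refl))))) = twoHubs-counterexample true
  targets-are-counterexamples T (there (there (there (there (there (here refl)))))) = oneHub-counterexample true

bounded⇒below-targets : ExcludedMiddle 0ℓ → (𝓗 : Family) →
  (∃[ c ] (∀ G → Connected G → Free 𝓗 G → numDeg≥2 G < c)) → ∃[ n ] (1 ≤ n × (𝓗 ≤F targetFamily n))
bounded⇒below-targets em 𝓗 (c , bound) = 3 + c , s≤s z≤n , λ T T∈targets →
  let connected , c≤#T = targets-are-counterexamples c T T∈targets in
  -- The bound only shows that T is not 𝓗-free; excluded middle produces the member of 𝓗 inside T.
  em⇒dne em λ ∄H → ℕₚ.<⇒≱ (bound T connected λ H H∈𝓗 H≺T → ∄H (H , H∈𝓗 , H≺T)) c≤#T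

-- Finding the targets and paths as induced subgraphs
module _ (G : Graph) where
  private
    V : Set
    V = Fin (order G)

  Independent : ∀ {k} → (Fin k → V) → Set
  Independent f = ∀ i j → adj G (f i) (f j) ≡ false

  Clique : ∀ {k} → (Fin k → V) → Set
  Clique f = ∀ {i j} → i ≢ j → adj G (f i) (f j) ≡ true

  clique⇒Kn : ∀ {k} (q : Fin k → V) → Clique q → Kn k ≺ G
  clique⇒Kn q q-adj = Presentation.embed (present-Kn _) {G} q q-inj (λ _ _ → q-adj)
    where
    q-inj : Injective _≡_ _≡_ q
    q-inj {i} {j} qi≡qj with i ≟ j
    ... | yes i≡j = i≡j
    ... | no  i≢j = contradiction qi≡qj (adj⇒≢ G (q-adj i≢j))

  Kn-or-independent : ∀ a b {M} (h : Fin M → V) → ramseyBound a b ≤ M →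
                      Kn a ≺ G ⊎ Σ[ g ∈ (Fin b → Fin M) ] (Increasing g × Independent (λ i → h (g i)))
  Kn-or-independent a b h bound with ramsey a b (λ i j → adj G (h i) (h j)) bound
  ... | inj₁ (monochromatic g _ clique) = inj₁ (clique⇒Kn (λ i → h (g i)) clique′)
    where
    clique′ : Clique (λ i → h (g i))
    clique′ {i} {j} i≢j with Finₚ.<-cmp i j
    ... | tri< i<j _ _ = clique i<j
    ... | tri≈ _ i≡j _ = contradiction i≡j i≢j
    ... | tri> _ _ j<i = trans (adj-sym G _ _) (clique j<i)
  ... | inj₂ (monochromatic g g-inc indep) = inj₂ (g , g-inc , indep′)
    where
    indep′ : Independent (λ i → h (g i))
    indep′ i j with Finₚ.<-cmp i j
    ... | tri< i<j _ _ = indep i<j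
    ... | tri≈ _ refl _ = adj-irrefl G _
    ... | tri> _ _ j<i = trans (adj-sym G _ _) (indep j<i)

  twoHubs-embedding : ∀ {n} (v x : V) (f : Fin n → V) → v ≢ x → Injective _≡_ _≡_ f → Independent f →
                      (∀ i → adj G v (f i) ≡ true) → (∀ i → adj G x (f i) ≡ true) → twoHubs (adj G v x) n ≺ G
  twoHubs-embedding {n} v x f v≢x f-inj f-indep vf xf =
    Presentation.embed (present-twoHubs (adj G v x) n) {G} φ φ-inj φ-adj
    where
    φ : Fin 2 ⊎ Fin n → V
    φ (inj₁ zero)       = v
    φ (inj₁ (suc zero)) = x
    φ (inj₂ i)          = f i
    φ-inj : Injective _≡_ _≡_ φ
    φ-inj {inj₁ zero}       {inj₁ zero}       _  = refl
    φ-inj {inj₁ zero}       {inj₁ (suc zero)} eq = contradiction eq v≢x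
    φ-inj {inj₁ (suc zero)} {inj₁ zero}       eq = contradiction (sym eq) v≢x
    φ-inj {inj₁ (suc zero)} {inj₁ (suc zero)} _  = refl
    φ-inj {inj₁ zero}       {inj₂ j}          eq = contradiction eq (adj⇒≢ G (vf j))
    φ-inj {inj₁ (suc zero)} {inj₂ j}          eq = contradiction eq (adj⇒≢ G (xf j))
    φ-inj {inj₂ i}          {inj₁ zero}       eq = contradiction (sym eq) (adj⇒≢ G (vf i))
    φ-inj {inj₂ i}          {inj₁ (suc zero)} eq = contradiction (sym eq) (adj⇒≢ G (xf i))
    φ-inj {inj₂ i}          {inj₂ j}          eq = cong inj₂ (f-inj eq)
    φ-adj : ∀ a b → a ≢ b → adj G (φ a) (φ b) ≡ twoHubs-edge (adj G v x) a b
    φ-adj (inj₁ zero)       (inj₁ zero)       a≢b = contradiction refl a≢b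
    φ-adj (inj₁ zero)       (inj₁ (suc zero)) _   = refl
    φ-adj (inj₁ (suc zero)) (inj₁ zero)       _   = adj-sym G x v
    φ-adj (inj₁ (suc zero)) (inj₁ (suc zero)) a≢b = contradiction refl a≢b
    φ-adj (inj₁ zero)       (inj₂ j)          _   = vf j
    φ-adj (inj₁ (suc zero)) (inj₂ j)          _   = xf j
    φ-adj (inj₂ i)          (inj₁ zero)       _   = trans (adj-sym G (f i) v) (vf i)
    φ-adj (inj₂ i)          (inj₁ (suc zero)) _   = trans (adj-sym G (f i) x) (xf i)
    φ-adj (inj₂ i)          (inj₂ j)          _   = f-indep i j

  oneHub-embedding : ∀ {n} b (v : V) (f w : Fin n → V) → Injective _≡_ _≡_ f → Independent f → Independent w →
                     (∀ i → adj G v (f i) ≡ true) → (∀ i → adj G v (w i) ≡ b) → (∀ i → v ≢ w i) →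
                     (∀ i j → adj G (f i) (w j) ≡ does (i ≟ j)) → oneHub b n ≺ G
  oneHub-embedding {n} b v f w f-inj f-indep w-indep vf vw v≢w fw =
    Presentation.embed (present-oneHub b n) {G} φ φ-inj φ-adj
    where
    φ : Star n → V
    φ centre      = v
    φ (leaf i)    = f i
    φ (pendant i) = w i
    matched : ∀ i → adj G (f i) (w i) ≡ true
    matched i = trans (fw i i) (dec-true (i ≟ i) refl)
    w-inj : Injective _≡_ _≡_ w
    w-inj {i} {j} wi≡wj with i ≟ j | fw i j
    ... | yes i≡j | _    = i≡j
    ... | no  _   | fiwj = contradiction (trans (cong (adj G (f i)) wi≡wj) fiwj) (not-¬ (matched i))
    f≢w : ∀ i j → f i ≢ w j
    f≢w i j fi≡wj = contradiction (f-indep j i) (not-¬ (trans (cong (adj G (f j)) fi≡wj) (matched j)))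
    φ-inj : Injective _≡_ _≡_ φ
    φ-inj {centre}    {centre}    _  = refl
    φ-inj {centre}    {leaf j}    eq = contradiction eq (adj⇒≢ G (vf j))
    φ-inj {centre}    {pendant j} eq = contradiction eq (v≢w j)
    φ-inj {leaf i}    {centre}    eq = contradiction (sym eq) (adj⇒≢ G (vf i))
    φ-inj {leaf i}    {leaf j}    eq = cong leaf (f-inj eq)
    φ-inj {leaf i}    {pendant j} eq = contradiction eq (f≢w i j)
    φ-inj {pendant i} {centre}    eq = contradiction (sym eq) (v≢w i)
    φ-inj {pendant i} {leaf j}    eq = contradiction (sym eq) (f≢w j i)
    φ-inj {pendant i} {pendant j} eq = cong pendant (w-inj eq)
    φ-adj : ∀ a a′ → a ≢ a′ → adj G (φ a) (φ a′) ≡ oneHub-edge b a a′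
    φ-adj centre      centre      a≢a′ = contradiction refl a≢a′
    φ-adj centre      (leaf j)    _    = vf j
    φ-adj centre      (pendant j) _    = vw j
    φ-adj (leaf i)    centre      _    = trans (adj-sym G (f i) v) (vf i)
    φ-adj (leaf i)    (leaf j)    _    = f-indep i j
    φ-adj (leaf i)    (pendant j) _    = fw i j
    φ-adj (pendant i) centre      _    = trans (adj-sym G (w i) v) (vw i)
    φ-adj (pendant i) (leaf j)    _    = trans (adj-sym G (w i) (f j)) (trans (fw j i) (does-sym j i))
    φ-adj (pendant i) (pendant j) _    = w-indep i j

  induced-path : ∀ k (q : ℕ → V) → (∀ {i j} → i < k → j < k → q i ≡ q j → i ≡ j) →
                 (∀ {i} → suc i < k → adj G (q i) (q (suc i)) ≡ true) →
                 (∀ {i j} → suc i < j → j < k → adj G (q i) (q j) ≡ false) → Pn k ≺ G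
  induced-path k q q-inj q-step q-far = Presentation.embed (present-Pn k) {G} (λ i → q (toℕ i))
    (λ eq → Finₚ.toℕ-injective (q-inj (Finₚ.toℕ<n _) (Finₚ.toℕ<n _) eq)) φ-adj
    where
    ordered : ∀ {x y} → x < y → y < k → adj G (q x) (q y) ≡ (y ≡ᵇ suc x) ∨ (x ≡ᵇ suc y)
    ordered {x} {y} x<y y<k with y ℕ.≟ suc x
    ... | yes refl = trans (q-step y<k) (sym (cong (_∨ (x ≡ᵇ suc (suc x))) (dec-true (suc x ℕ.≟ suc x) refl)))
    ... | no  y≢1+x = trans (q-far (ℕₚ.≤∧≢⇒< x<y (λ 1+x≡y → y≢1+x (sym 1+x≡y))) y<k)
                            (sym (cong₂ _∨_ (dec-false (y ℕ.≟ suc x) y≢1+x)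
                                            (dec-false (x ℕ.≟ suc y) (ℕₚ.<⇒≢ (ℕₚ.<-trans x<y (ℕₚ.n<1+n y))))))
    φ-adj : ∀ a b → a ≢ b → adj G (q (toℕ a)) (q (toℕ b)) ≡ E (Pn k) a b ∨ E (Pn k) b a
    φ-adj a b a≢b with ℕₚ.<-cmp (toℕ a) (toℕ b)
    ... | tri< a<b _ _ = ordered a<b (Finₚ.toℕ<n b)
    ... | tri≈ _ a≡b _ = contradiction (Finₚ.toℕ-injective a≡b) a≢b
    ... | tri> _ _ b<a =
      trans (adj-sym G _ _) (trans (ordered b<a (Finₚ.toℕ<n a)) (∨-comm (toℕ a ≡ᵇ suc (toℕ b)) _))

matchingBound independentBound neighbourBound : ℕ → ℕ
matchingBound    n = ramseyBound n (n + n)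
independentBound n = ramseyBound (suc n) (ramseyBound (suc n) (matchingBound n))
neighbourBound   n = ramseyBound n (independentBound n)

module NeighbourhoodBound (G : Graph) (n : ℕ) (Kn⊀G : ¬ Kn n ≺ G)
                          (twoHubs⊀G : ∀ b → ¬ twoHubs b n ≺ G) (oneHub⊀G : ∀ b → ¬ oneHub b n ≺ G) where
  private
    V : Set
    V = Fin (order G)

  no-second-hub : ∀ {M} (v x : V) (f : Fin M → V) → Injective _≡_ _≡_ f → Independent G f →
                  (∀ i → adj G v (f i) ≡ true) → x ≢ v → ¬ Enumeration (λ j → adj G x (f j)) n
  no-second-hub v x f f-inj f-indep vf x≢v (enumeration g g-inc xg) =
    twoHubs⊀G (adj G v x) (twoHubs-embedding G v x (λ j → f (g j)) (λ v≡x → x≢v (sym v≡x))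
                   (λ eq → increasing⇒injective g-inc (f-inj eq)) (λ i j → f-indep (g i) (g j)) (λ j → vf (g j)) xg)

  no-hanging-matching : ∀ {K} (v : V) (f w : Fin K → V) → matchingBound n ≤ K →
                        Injective _≡_ _≡_ f → Independent G f → (∀ i → adj G v (f i) ≡ true) → (∀ i → v ≢ w i) →
                        (∀ i j → adj G (f i) (w j) ≡ does (i ≟ j)) → ⊥
  no-hanging-matching v f w bound f-inj f-indep vf v≢w fw with Kn-or-independent G n (n + n) w bound
  ... | inj₁ Kn≺G = Kn⊀G Kn≺G
  ... | inj₂ (g , g-inc , wg-indep)
    with b , g′ , g′-inc , vwgg′ ← constant-subsequence n (λ i → adj G v (w (g i))) =
    oneHub⊀G b (oneHub-embedding G b v (λ i → f (s i)) (λ i → w (s i)) (λ eq → s-inj (f-inj eq))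
                  (λ i j → f-indep (s i) (s j)) (λ i j → wg-indep (g′ i) (g′ j)) (λ i → vf (s i)) vwgg′
                  (λ i → v≢w (s i)) (λ i j → trans (fw (s i) (s j)) (does-injective s-inj i j)))
    where
    s : Fin n → _
    s i = g (g′ i)
    s-inj : Injective _≡_ _≡_ s
    s-inj = increasing⇒injective (increasing-∘ g-inc g′-inc)

  no-independent-neighbours : ∀ (v : V) (f w : Fin (independentBound n) → V) →
                              Injective _≡_ _≡_ f → Independent G f → (∀ i → adj G v (f i) ≡ true) →
                              (∀ i → v ≢ w i) → (∀ i → adj G (f i) (w i) ≡ true) → ⊥
  no-independent-neighbours v f w f-inj f-indep vf v≢w fw
    with rich-row-or-antichain n (matchingBound n) (λ i j → adj G (w i) (f j)) ≤-refl
  ... | inj₁ (i , row) = no-second-hub v (w i) f f-inj f-indep vf (λ wi≡v → v≢w i (sym wi≡v)) row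
  ... | inj₂ antichain@(monochromatic c c-inc _) =
    no-hanging-matching v (λ p → f (c p)) (λ p → w (c p)) ≤-refl (λ eq → increasing⇒injective c-inc (f-inj eq))
                        (λ p q → f-indep (c p) (c q)) (λ p → vf (c p)) (λ p → v≢w (c p)) matching
    where
    matching : ∀ p q → adj G (f (c p)) (w (c q)) ≡ does (p ≟ q)
    matching p q with p ≟ q
    ... | yes refl = fw (c p)
    ... | no  p≢q  =
      trans (adj-sym G _ _) (antichain-≢ {r = λ i j → adj G (w i) (f j)} antichain (λ q≡p → p≢q (sym q≡p)))

  few-neighbours-of-deg≥2 : ∀ v → countB (λ u → adj G v u ∧ deg≥2 G u) < neighbourBound n
  few-neighbours-of-deg≥2 v with neighbourBound n ℕ.≤? countB (λ u → adj G v u ∧ deg≥2 G u)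
  ... | no  R≰# = ℕₚ.≰⇒> R≰#
  ... | yes R≤# with enumeration h h-inc vh ← enumerate _ _ R≤# with Kn-or-independent G n _ h ≤-refl
  ...   | inj₁ Kn≺G = ⊥-elim (Kn⊀G Kn≺G)
  ...   | inj₂ (g , g-inc , hg-indep) =
    ⊥-elim (no-independent-neighbours v (λ i → h (g i)) (λ i → proj₁ (other i))
              (increasing⇒injective (increasing-∘ h-inc g-inc)) hg-indep (λ i → ∧-conicalˡ _ _ (vh (g i)))
              (λ i v≡w → proj₁ (proj₂ (other i)) (sym v≡w)) (λ i → proj₂ (proj₂ (other i))))
    where
    other : ∀ i → Σ[ w ∈ V ] (w ≢ v × adj G (h (g i)) w ≡ true)
    other i = deg≥2⇒another-neighbour G (∧-conicalʳ _ _ (vh (g i))) v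

-- Balls grown through vertices of degree at least two
ballBound : ℕ → ℕ → ℕ
ballBound R zero    = 0
ballBound R (suc k) = suc (ballBound R k + R * ballBound R k)

module Balls (G : Graph) (v : Fin (order G)) where
  private
    V : Set
    V = Fin (order G)

  -- The vertices reached from v by a walk of fewer than k edges whose vertices, except possibly
  -- the last, all have degree at least 2.
  ball : ℕ → V → Bool
  ball zero    u = false
  ball (suc k) u = does (u ≟ v) ∨ ball k u ∨ anyB (λ x → (deg≥2 G x ∧ ball k x) ∧ adj G x u)

  ball-suc : ∀ k {u} → ball k u ≡ true → ball (suc k) u ≡ true
  ball-suc k {u} u∈k = ∨-introʳ (does (u ≟ v)) (∨-introˡ _ u∈k)

  ball-mono : ∀ {k j u} → k ≤ j → ball k u ≡ true → ball j u ≡ true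
  ball-mono {k} {j} {u} k≤j u∈k with o , refl ← ℕₚ.m≤n⇒∃[o]m+o≡n k≤j = grow o
    where
    grow : ∀ o → ball (k + o) u ≡ true
    grow zero    = subst (λ m → ball m u ≡ true) (sym (ℕₚ.+-identityʳ k)) u∈k
    grow (suc o) = subst (λ m → ball m u ≡ true) (sym (+-suc k o)) (ball-suc (k + o) (grow o))

  centre∈ball : ∀ k → ball (suc k) v ≡ true
  centre∈ball k rewrite dec-true (v ≟ v) refl = refl

  ball-step : ∀ k {x u} → deg≥2 G x ≡ true → ball k x ≡ true → adj G x u ≡ true → ball (suc k) u ≡ true
  ball-step k {x} {u} x≥2 x∈k xu = ∨-introʳ (does (u ≟ v)) (∨-introʳ (ball k u)
    (anyB-intro (λ y → (deg≥2 G y ∧ ball k y) ∧ adj G y u) x (cong₂ _∧_ (cong₂ _∧_ x≥2 x∈k) xu)))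

  ball-suc-cases : ∀ k {u} → ball (suc k) u ≡ true →
                   u ≡ v ⊎ ball k u ≡ true ⊎ Σ[ x ∈ V ] (deg≥2 G x ≡ true × ball k x ≡ true × adj G x u ≡ true)
  ball-suc-cases k {u} u∈k+1 with u ≟ v | ball k u in u∈k
  ... | yes u≡v | _    = inj₁ u≡v
  ... | no  _   | true = inj₂ (inj₁ refl)
  ... | no  _   | false with x , x-ok ← anyB-elim (λ y → (deg≥2 G y ∧ ball k y) ∧ adj G y u) u∈k+1 =
    inj₂ (inj₂ (x , ∧-conicalˡ (deg≥2 G x) (ball k x) x∈k≥2 , ∧-conicalʳ (deg≥2 G x) (ball k x) x∈k≥2 ,
                ∧-conicalʳ (deg≥2 G x ∧ ball k x) (adj G x u) x-ok))
    where x∈k≥2 = ∧-conicalˡ (deg≥2 G x ∧ ball k x) (adj G x u) x-ok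

  ball-parent : ∀ k {u} → ball k u ≡ true → u ≢ v →
                Σ[ x ∈ V ] (deg≥2 G x ≡ true × ball k x ≡ true × adj G x u ≡ true)
  ball-parent (suc k) {u} u∈k+1 u≢v with ball-suc-cases k {u} u∈k+1
  ... | inj₁ u≡v = contradiction u≡v u≢v
  ... | inj₂ (inj₁ u∈k) with x , x≥2 , x∈k , xu ← ball-parent k u∈k u≢v = x , x≥2 , ball-suc k x∈k , xu
  ... | inj₂ (inj₂ (x , x≥2 , x∈k , xu)) = x , x≥2 , ball-suc k x∈k , xu

  Level : ℕ → V → Set
  Level l u = ball (suc l) u ≡ true × ball l u ≡ false

  level-unique : ∀ {a b u} → Level a u → Level b u → a ≡ b
  level-unique {a} {b} (u∈a+1 , u∉a) (u∈b+1 , u∉b) with ℕₚ.<-cmp a b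
  ... | tri< a<b _ _ = contradiction (ball-mono a<b u∈a+1) (not-¬ u∉b)
  ... | tri≈ _ a≡b _ = a≡b
  ... | tri> _ _ b<a = contradiction (ball-mono b<a u∈b+1) (not-¬ u∉a)

  level-parent : ∀ k {u} → Level (suc k) u → Σ[ x ∈ V ] (Level k x × deg≥2 G x ≡ true × adj G x u ≡ true)
  level-parent k {u} (u∈k+2 , u∉k+1) with ball-suc-cases (suc k) {u} u∈k+2
  ... | inj₁ refl = contradiction (centre∈ball k) (not-¬ u∉k+1)
  ... | inj₂ (inj₁ u∈k+1) = contradiction u∈k+1 (not-¬ u∉k+1)
  ... | inj₂ (inj₂ (x , x≥2 , x∈k+1 , xu)) =
    x , (x∈k+1 , ¬-not λ x∈k → not-¬ (ball-step k x≥2 x∈k xu) u∉k+1) , x≥2 , xu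

  record LevelledPath (k : ℕ) (u : V) : Set where
    field
      vertex    : ℕ → V
      starts-at : vertex 0 ≡ u
      levelled  : ∀ {l j} → l + j ≡ k → Level l (vertex j)
      steps     : ∀ {j} → j < k → adj G (vertex j) (vertex (suc j)) ≡ true
      inner≥2   : ∀ {j} → j < k → deg≥2 G (vertex (suc j)) ≡ true

  levelled-path : ∀ k {u} → Level k u → LevelledPath k u
  levelled-path zero {u} u-level = record
    { vertex    = λ _ → u
    ; starts-at = refl
    ; levelled  = λ {l} l+j≡0 → subst (λ l → Level l u) (sym (ℕₚ.m+n≡0⇒m≡0 l l+j≡0)) u-level
    ; steps     = λ ()
    ; inner≥2   = λ ()
    }
  levelled-path (suc k) {u} u-level with x , x-level , x≥2 , xu ← level-parent k u-level = record
    { vertex    = vertex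
    ; starts-at = refl
    ; levelled  = λ {l} {j} → levelled {l} {j}
    ; steps     = λ {j} → steps {j}
    ; inner≥2   = λ {j} → inner≥2 {j}
    }
    where
    module P = LevelledPath (levelled-path k x-level)
    vertex : ℕ → V
    vertex zero    = u
    vertex (suc j) = P.vertex j
    levelled : ∀ {l j} → l + j ≡ suc k → Level l (vertex j)
    levelled {l} {zero}  l+0≡k+1 =
      subst (λ l → Level l u) (sym (trans (sym (ℕₚ.+-identityʳ l)) l+0≡k+1)) u-level
    levelled {l} {suc j} eq      = P.levelled (ℕₚ.suc-injective (trans (sym (+-suc l j)) eq))
    steps : ∀ {j} → j < suc k → adj G (vertex j) (vertex (suc j)) ≡ true
    steps {zero}  _         = trans (cong (adj G u) P.starts-at) (trans (adj-sym G u x) xu)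
    steps {suc j} (s≤s j<k) = P.steps j<k
    inner≥2 : ∀ {j} → j < suc k → deg≥2 G (vertex (suc j)) ≡ true
    inner≥2 {zero}  _         = subst (λ y → deg≥2 G y ≡ true) (sym P.starts-at) x≥2
    inner≥2 {suc j} (s≤s j<k) = P.inner≥2 j<k

  private
    gap : ∀ {i j k} → 2 + i ≤ j → j ≤ k → 2 + (k ∸ j) ≤ k ∸ i
    gap {i} {j} {k} 2+i≤j j≤k = ℕₚ.+-cancelʳ-≤ i (2 + (k ∸ j)) (k ∸ i) (begin
      2 + (k ∸ j) + i   ≡⟨ sym (trans (+-suc (k ∸ j) (suc i)) (cong suc (+-suc (k ∸ j) i))) ⟩
      (k ∸ j) + (2 + i) ≤⟨ ℕₚ.+-monoʳ-≤ (k ∸ j) 2+i≤j ⟩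
      (k ∸ j) + j       ≡⟨ ℕₚ.m∸n+n≡m j≤k ⟩
      k                 ≡⟨ sym (ℕₚ.m∸n+n≡m (≤-trans (ℕₚ.m≤n+m i 2) (≤-trans 2+i≤j j≤k))) ⟩
      (k ∸ i) + i       ∎)
      where open ℕₚ.≤-Reasoning

  -- A vertex of degree at least 2 has all its neighbours at most one level above it, so path
  -- vertices two apart are non-adjacent and the path is induced.
  levelled-path⇒Pn : ∀ {k u} → LevelledPath k u → Pn k ≺ G
  levelled-path⇒Pn {k} P = induced-path G k vertex injective (λ i+1<k → steps (ℕₚ.<-trans (n<1+n _) i+1<k)) far
    where
    open LevelledPath P
    level-at : ∀ {j} → j ≤ k → Level (k ∸ j) (vertex j)
    level-at j≤k = levelled (ℕₚ.m∸n+n≡m j≤k)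
    injective : ∀ {i j} → i < k → j < k → vertex i ≡ vertex j → i ≡ j
    injective {i} {j} i<k j<k eq = ℕₚ.+-cancelˡ-≡ (k ∸ j) i j
      (trans (cong (_+ i) (sym same-level))
             (trans (ℕₚ.m∸n+n≡m (ℕₚ.<⇒≤ i<k)) (sym (ℕₚ.m∸n+n≡m (ℕₚ.<⇒≤ j<k)))))
      where
      same-level : k ∸ i ≡ k ∸ j
      same-level = level-unique (subst (Level (k ∸ i)) eq (level-at (ℕₚ.<⇒≤ i<k))) (level-at (ℕₚ.<⇒≤ j<k))
    far : ∀ {i j} → suc i < j → j < k → adj G (vertex i) (vertex j) ≡ false
    far {i} {suc j} 2+i≤1+j 1+j<k = ¬-not λ adjacent →
      not-¬ (ball-mono (gap 2+i≤1+j (ℕₚ.<⇒≤ 1+j<k))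
                       (ball-step (suc (k ∸ suc j)) (inner≥2 (ℕₚ.<-trans (n<1+n j) 1+j<k))
                                  (proj₁ (level-at (ℕₚ.<⇒≤ 1+j<k))) (trans (adj-sym G _ _) adjacent)))
            (proj₂ (level-at (ℕₚ.<⇒≤ (ℕₚ.<-trans (ℕₚ.<-trans (n<1+n i) 2+i≤1+j) 1+j<k))))

  module _ {n : ℕ} (Pn⊀G : ¬ Pn n ≺ G) (v≥2 : deg≥2 G v ≡ true) where

    ball-closed : ∀ {x y} → ball n x ≡ true → adj G x y ≡ true → ball n y ≡ true
    ball-closed {x} {y} x∈n xy with deg≥2 G x in x≥2
    ... | true  = ¬-not λ y∉n → Pn⊀G (levelled-path⇒Pn (levelled-path n (ball-step n x≥2 x∈n xy , y∉n)))
    ... | false with x ≟ v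
    ...   | yes refl = contradiction x≥2 (not-¬ v≥2)
    ...   | no  x≢v with z , z≥2 , z∈n , zx ← ball-parent n x∈n x≢v with y ≟ z
    ...     | yes refl = z∈n
    ...     | no  y≢z  = contradiction x≥2 (not-¬ (two-neighbours⇒deg≥2 G y≢z xy (trans (adj-sym G x z) zx)))

    reach-ball : ∀ {x u} → Reach G x u → ball n x ≡ true → ball n u ≡ true
    reach-ball here             x∈n = x∈n
    reach-ball (step xw w⇝u) x∈n = reach-ball w⇝u (ball-closed x∈n xw)

    connected⇒everything-in-ball : Connected G → 1 ≤ n → ∀ u → ball n u ≡ true
    connected⇒everything-in-ball connected 1≤n u = reach-ball (connected v u) (ball-mono 1≤n (centre∈ball 0))

  count-deg≥2-in-ball : ∀ R → (∀ x → countB (λ u → adj G x u ∧ deg≥2 G u) ≤ R) →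
                        ∀ k → countB (λ u → deg≥2 G u ∧ ball k u) ≤ ballBound R k
  count-deg≥2-in-ball R few zero =
    ≤-trans (countB-mono _ (λ _ → false) (λ u eq → trans (sym (∧-zeroʳ (deg≥2 G u))) eq))
            (≤-reflexive (countB-false {order G}))
  count-deg≥2-in-ball R few (suc k) =
    ≤-trans (countB-mono _ _ covered)
   (≤-trans (countB-∨ (λ u → does (u ≟ v)) (λ u → inner u ∨ frontier u))
            (+-mono-≤ (≤-reflexive (countB-≟ v))
                      (≤-trans (countB-∨ inner frontier)
                               (+-mono-≤ IH (≤-trans (countB-anyB R inner (λ x u → adj G x u ∧ deg≥2 G u) (λ x _ → few x))
                                                     (ℕₚ.*-monoʳ-≤ R IH))))))
    where
    IH = count-deg≥2-in-ball R few k
    inner frontier : V → Bool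
    inner u    = deg≥2 G u ∧ ball k u
    frontier u = anyB (λ x → inner x ∧ (adj G x u ∧ deg≥2 G u))
    covered : ∀ u → deg≥2 G u ∧ ball (suc k) u ≡ true → does (u ≟ v) ∨ inner u ∨ frontier u ≡ true
    covered u u-ok with ball-suc-cases k {u} (∧-conicalʳ (deg≥2 G u) _ u-ok)
    ... | inj₁ refl = cong (_∨ (inner v ∨ frontier v)) (dec-true (v ≟ v) refl)
    ... | inj₂ (inj₁ u∈k) = ∨-introʳ (does (u ≟ v)) (∨-introˡ (frontier u) (cong₂ _∧_ u≥2 u∈k))
      where u≥2 = ∧-conicalˡ (deg≥2 G u) _ u-ok
    ... | inj₂ (inj₂ (x , x≥2 , x∈k , xu)) =
      ∨-introʳ (does (u ≟ v)) (∨-introʳ (inner u)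
        (anyB-intro (λ x → inner x ∧ (adj G x u ∧ deg≥2 G u)) x
                    (cong₂ _∧_ (cong₂ _∧_ x≥2 x∈k) (cong₂ _∧_ xu u≥2))))
      where u≥2 = ∧-conicalˡ (deg≥2 G u) _ u-ok

numDeg≥2-bounded : ∀ G {n} → 1 ≤ n → Connected G → ¬ Pn n ≺ G →
                   ∀ R → (∀ x → countB (λ u → adj G x u ∧ deg≥2 G u) ≤ R) → numDeg≥2 G ≤ ballBound R n
numDeg≥2-bounded G {n} 1≤n connected Pn⊀G R few with numDeg≥2 G ℕ.≟ 0
... | yes #≡0 = ≤-trans (≤-reflexive #≡0) z≤n
... | no  #≢0 with enumeration g _ g≥2 ← enumerate (deg≥2 G) 1 (ℕₚ.n≢0⇒n>0 #≢0) =
  ≤-trans (countB-mono (deg≥2 G) (λ u → deg≥2 G u ∧ ball n u) λ u u≥2 → cong₂ _∧_ u≥2 (everything-in-ball u))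
          (count-deg≥2-in-ball R few n)
  where
  open Balls G (g zero)
  everything-in-ball : ∀ u → ball n u ≡ true
  everything-in-ball = connected⇒everything-in-ball Pn⊀G (g≥2 zero) connected 1≤n

below-targets⇒bounded : (𝓗 : Family) → ∃[ n ] (1 ≤ n × (𝓗 ≤F targetFamily n)) →
                         ∃[ c ] (∀ G → Connected G → Free 𝓗 G → numDeg≥2 G < c)
below-targets⇒bounded 𝓗 (n , 1≤n , 𝓗≤targets) = suc (ballBound (neighbourBound n) n) , bounded
  where
  bounded : ∀ G → Connected G → Free 𝓗 G → numDeg≥2 G < suc (ballBound (neighbourBound n) n)
  bounded G connected 𝓗-free =
    s≤s (numDeg≥2-bounded G 1≤n connected (free (there (here refl))) (neighbourBound n)
                          (λ x → ℕₚ.<⇒≤ (few-neighbours-of-deg≥2 x)))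
    where
    free : ∀ {T} → targetFamily n T → ¬ T ≺ G
    free = ≤F⇒Free {G = G} 𝓗≤targets 𝓗-free _
    twoHubs⊀G : ∀ b → ¬ twoHubs b n ≺ G
    twoHubs⊀G false = free (there (there (there (here refl))))
    twoHubs⊀G true  = free (there (there (there (there (here refl)))))
    oneHub⊀G : ∀ b → ¬ oneHub b n ≺ G
    oneHub⊀G false = free (there (there (here refl)))
    oneHub⊀G true  = free (there (there (there (there (there (here refl))))))
    open NeighbourhoodBound G n (free (here refl)) twoHubs⊀G oneHub⊀G

theorem1p6 : ExcludedMiddle 0ℓ → (𝓗 : Family) →
    (∃[ c ] (∀ G → Connected G → Free 𝓗 G → numDeg≥2 G < c))
    ⇔ (∃[ n ] (1 ≤ n × (𝓗 ≤F targetFamily n)))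
theorem1p6 em 𝓗 = mk⇔ (bounded⇒below-targets em 𝓗) (below-targets⇒bounded 𝓗)
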